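{- For every nonnegative integer $m$, the coefficient $d_{m1}$ of $t^m$ in $g_{m1}(t)$ (defined in the context) equals $(-1)^m$.
   Context: The polynomials $f_{mi}(t)\in\mathbb{Q}[t]$, for integers $m\geqslant 0$ and $0\leqslant i\leqslant m+1$, are defined by $f_{00}(t)=\frac12 t-1$, $f_{01}(t)=1$ and, for $m\geqslant 1$: $f_{m0}(t)=tf_{m-1,0}'(t)$; $f_{m,m+1}(t)=-mf_{m-1,m}(t)$; and $f_{mi}(t)=tf'_{m-1,i}(t)+i(1-t)f_{m-1,i}(t)-(i-1)f_{m-1,i-1}(t)$ for $1\leqslant i\leqslant m$. For $m\geqslant 0$ let $A_m(t)$ be the $(m+1)\times(m+1)$ lower triangular matrix whose entry in row $r$ ($0\leqslant r\leqslant m$) and column $i$ ($1\leqslant i\leqslant r+1$) is $f_{ri}(t)$; it is invertible (diagonal entries $(-1)^r r!$). Let $g_{ri}(t)$ denote the entry in row $r$, column $i$ of $A_m(t)^{ -1}$ (independent of $m\geqslant r$); $g_{m1}(t)$ is a polynomial of degree at most $m$. -}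

module Defs where

open import Data.Nat as ℕ using (ℕ; zero; suc; _<ᵇ_; _≡ᵇ_)
open import Data.Integer using (+_)
open import Data.Rational using (ℚ; 0ℚ; 1ℚ; ½; -_; _+_; _*_; _/_)
open import Data.Bool using (if_then_else_)
open import Data.List using (List; []; _∷_)
open import Data.Fin using (Fin; toℕ)
open import Relation.Binary.PropositionalEquality using (_≡_)

-- Polynomials in Q[t] as coefficient lists (constant term first).
Poly : Set
Poly = List ℚ

coeff : Poly → ℕ → ℚ
coeff []       _       = 0ℚ
coeff (a ∷ p)  zero    = a
coeff (a ∷ p)  (suc k) = coeff p k

_≈ₚ_ : Poly → Poly → Set
p ≈ₚ q = ∀ k → coeff p k ≡ coeff q k

0ₚ : Poly
0ₚ = []

1ₚ : Poly
1ₚ = 1ℚ ∷ []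

tₚ : Poly
tₚ = 0ℚ ∷ 1ℚ ∷ []

constₚ : ℚ → Poly
constₚ c = c ∷ []

_+ₚ_ : Poly → Poly → Poly
[]      +ₚ q       = q
(a ∷ p) +ₚ []      = a ∷ p
(a ∷ p) +ₚ (b ∷ q) = (a + b) ∷ (p +ₚ q)

scaleₚ : ℚ → Poly → Poly
scaleₚ c []      = []
scaleₚ c (a ∷ p) = (c * a) ∷ scaleₚ c p

_*ₚ_ : Poly → Poly → Poly
[]      *ₚ q = []
(a ∷ p) *ₚ q = scaleₚ a q +ₚ (0ℚ ∷ (p *ₚ q))

-_ₚ : Poly → Poly
-_ₚ p = scaleₚ (- 1ℚ) p

derivAux : ℕ → Poly → Poly
derivAux n []      = []
derivAux n (a ∷ p) = ((+ n / 1) * a) ∷ derivAux (suc n) p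

deriv : Poly → Poly
deriv []      = []
deriv (a ∷ p) = derivAux 1 p

ℕtoℚ : ℕ → ℚ
ℕtoℚ n = + n / 1

-- The polynomials f_{mi}(t); f m i = 0 outside 0 ≤ i ≤ m+1.
f : ℕ → ℕ → Poly
f zero zero = constₚ (- 1ℚ) +ₚ scaleₚ ½ tₚ
f zero (suc zero) = 1ₚ
f zero (suc (suc i)) = 0ₚ
f (suc m) zero = tₚ *ₚ deriv (f m zero)
f (suc m) (suc i) =
  if i <ᵇ suc m
  then
       (tₚ *ₚ deriv (f m (suc i)))
         +ₚ ((scaleₚ (ℕtoℚ (suc i)) ((1ₚ +ₚ (-_ₚ tₚ)) *ₚ f m (suc i)))
         +ₚ (-_ₚ (scaleₚ (ℕtoℚ i) (f m i))))
  else if i ≡ᵇ suc m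
  then
       -_ₚ (scaleₚ (ℕtoℚ (suc m)) (f m (suc m)))
  else 0ₚ

-- A_m : rows r = 0..m, columns i = 1..m+1; Fin index j stands for column i = j+1.
A : (m : ℕ) → Fin (suc m) → Fin (suc m) → Poly
A m r j = if toℕ j <ᵇ suc (toℕ r) then f (toℕ r) (suc (toℕ j)) else 0ₚ

Matrix : ℕ → Set
Matrix n = Fin n → Fin n → Poly

sumₚ : (n : ℕ) → (Fin n → Poly) → Poly
sumₚ zero    g = 0ₚ
sumₚ (suc n) g = g Fin.zero +ₚ sumₚ n (λ k → g (Fin.suc k))
  where import Data.Fin as Fin

_·_ : {n : ℕ} → Matrix n → Matrix n → Matrix n
_·_ {n} M N r c = sumₚ n (λ k → M r k *ₚ N k c)

idM : (n : ℕ) → Matrix n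
idM n r c = if toℕ r ≡ᵇ toℕ c then 1ₚ else 0ₚ

IsInverse : {n : ℕ} → Matrix n → Matrix n → Set
IsInverse {n} M G =
  (∀ r c → (M · G) r c ≈ₚ idM n r c) × (∀ r c → (G · M) r c ≈ₚ idM n r c)
  where open import Data.Product using (_×_)

signℚ : ℕ → ℚ
signℚ zero    = 1ℚ
signℚ (suc m) = - signℚ m

module Submission where

-- Write deg p ≤ d for "all coefficients of p beyond t^d vanish".
-- (1) By induction on r, for 0 ≤ j ≤ r the polynomial f_{r,j+1} has degree
--     ≤ r - j and its coefficient of t^(r-j) is the number L r j, where
--     L r j is given by the recurrence L_{r+1,j} = -(j+1) L_{r,j} - j L_{r,j-1}
--     read off from the defining recurrence of f.  In particular the diagonal
--     entries f_{r,r+1} of A_m are the nonzero constants L r r.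
-- (2) The alternating sums of the rows of L telescope:
--     Σ_{i ≤ r} L r i (-1)^i = [r = 0].
-- (3) Column 0 of an inverse G of A_m solves the lower triangular system
--     Σ_{k ≤ r} f_{r,k+1} G_{k,0} = [r = 0].  Solving row by row, (1) and (2)
--     show by induction on r that G_{r,0} has degree ≤ r with leading
--     coefficient (-1)^r: in row r every term with k < r has degree ≤ r and
--     t^r-coefficient L r k (-1)^k, so the diagonal term L r r G_{r,0} must
--     cancel them beyond t^r and contribute L r r (-1)^r at t^r.

open import Defs
open import Data.Nat using (ℕ; suc)
open import Data.Fin using (Fin; fromℕ; zero)
open import Relation.Binary.PropositionalEquality using (_≡_)

open import Data.Nat as ℕ using (zero; _≤_; _<_; z≤n; s≤s; z<s; _∸_; _<ᵇ_; _≡ᵇ_)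
import Data.Nat.Properties as ℕ
open import Data.Fin as Fin using (toℕ)
import Data.Fin.Properties as Fin
open import Data.Rational using (ℚ; 0ℚ; 1ℚ; _+_; _*_; -_; _-_; 1/_; NonZero; ≢-nonZero)
open import Data.Rational.Properties
  using (+-*-commutativeRing; +-0-group; *-zeroˡ; *-zeroʳ; *-identityˡ; +-identityˡ; +-identityʳ;
         +-assoc; +-inverseʳ; *-inverseˡ; *-assoc; 1≢0; normalize-pos; pos⇒nonZero; _≟_)
open import Algebra.Properties.Group +-0-group using (∙-cancelˡ)
open import Data.List using ([]; _∷_)
open import Data.Bool using (true; false; if_then_else_)
open import Data.Product using (proj₁)
open import Data.Sum using (inj₁; inj₂)
open import Relation.Nullary.Decidable using (dec⇒maybe)
open import Relation.Binary.PropositionalEquality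
  using (refl; sym; trans; cong; cong₂; subst; subst₂; _≢_; module ≡-Reasoning)
open import Tactic.RingSolver using (solve-∀)
open import Tactic.RingSolver.Core.AlmostCommutativeRing using (AlmostCommutativeRing; fromCommutativeRing)

open ≡-Reasoning

ℚ-ring : AlmostCommutativeRing _ _
ℚ-ring = fromCommutativeRing +-*-commutativeRing (λ x → dec⇒maybe (0ℚ ≟ x))

*-cancelˡ : ∀ c x y → c ≢ 0ℚ → c * x ≡ c * y → x ≡ y
*-cancelˡ c x y c≢0 cx≡cy = begin
    x                ≡⟨ sym (*-identityˡ x) ⟩
    1ℚ * x           ≡⟨ cong (_* x) (sym (*-inverseˡ c)) ⟩
    (1/ c * c) * x   ≡⟨ *-assoc (1/ c) c x ⟩
    1/ c * (c * x)   ≡⟨ cong (1/ c *_) cx≡cy ⟩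
    1/ c * (c * y)   ≡⟨ sym (*-assoc (1/ c) c y) ⟩
    (1/ c * c) * y   ≡⟨ cong (_* y) (*-inverseˡ c) ⟩
    1ℚ * y           ≡⟨ *-identityˡ y ⟩
    y                ∎
  where instance _ = ≢-nonZero c≢0

*-nonzero : ∀ x y → x ≢ 0ℚ → y ≢ 0ℚ → x * y ≢ 0ℚ
*-nonzero x y x≢0 y≢0 xy≡0 = y≢0 (*-cancelˡ x y 0ℚ x≢0 (trans xy≡0 (sym (*-zeroʳ x))))

ℕtoℚ-suc-nonzero : ∀ n → ℕtoℚ (suc n) ≢ 0ℚ
ℕtoℚ-suc-nonzero n eq = nonzero⇒≢0 (pos⇒nonZero (ℕtoℚ (suc n)) {{normalize-pos (suc n) 1}}) eq
  where
    nonzero⇒≢0 : ∀ {p} → NonZero p → p ≢ 0ℚ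
    nonzero⇒≢0 nz refl = ℕ.NonZero.nonZero nz

<ᵇ-true : ∀ {m n} → m < n → (m <ᵇ n) ≡ true
<ᵇ-true {zero}  {suc n} _         = refl
<ᵇ-true {suc m} {suc n} (s≤s m<n) = <ᵇ-true m<n

<ᵇ-false : ∀ {m n} → n ≤ m → (m <ᵇ n) ≡ false
<ᵇ-false {m}     {zero}  _         = refl
<ᵇ-false {suc m} {suc n} (s≤s n≤m) = <ᵇ-false n≤m

≡ᵇ-refl : ∀ n → (n ≡ᵇ n) ≡ true
≡ᵇ-refl zero    = refl
≡ᵇ-refl (suc n) = ≡ᵇ-refl n

coeff-+ : ∀ p q k → coeff (p +ₚ q) k ≡ coeff p k + coeff q k
coeff-+ []      q       k       = sym (+-identityˡ _)
coeff-+ (a ∷ p) []      zero    = sym (+-identityʳ a)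
coeff-+ (a ∷ p) []      (suc k) = sym (+-identityʳ _)
coeff-+ (a ∷ p) (b ∷ q) zero    = refl
coeff-+ (a ∷ p) (b ∷ q) (suc k) = coeff-+ p q k

coeff-scale : ∀ c p k → coeff (scaleₚ c p) k ≡ c * coeff p k
coeff-scale c []      k       = sym (*-zeroʳ c)
coeff-scale c (a ∷ p) zero    = refl
coeff-scale c (a ∷ p) (suc k) = coeff-scale c p k

coeff-neg : ∀ p k → coeff (-_ₚ p) k ≡ - coeff p k
coeff-neg p k = trans (coeff-scale (- 1ℚ) p k) (neg-one (coeff p k))
  where
    neg-one : ∀ x → (- 1ℚ) * x ≡ - x
    neg-one = solve-∀ ℚ-ring

coeff-cons-* : ∀ a p q k → coeff ((a ∷ p) *ₚ q) k ≡ a * coeff q k + coeff (0ℚ ∷ (p *ₚ q)) k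
coeff-cons-* a p q k = trans (coeff-+ (scaleₚ a q) (0ℚ ∷ (p *ₚ q)) k)
                             (cong (_+ coeff (0ℚ ∷ (p *ₚ q)) k) (coeff-scale a q k))

DegreeAtMost : Poly → ℕ → Set
DegreeAtMost p d = ∀ n → d < n → coeff p n ≡ 0ℚ

record Leading (p : Poly) (d : ℕ) (c : ℚ) : Set where
  field
    bound : DegreeAtMost p d
    top   : coeff p d ≡ c
open Leading

coeff-*-constant : ∀ p q → DegreeAtMost p 0 → ∀ n → coeff (p *ₚ q) n ≡ coeff p 0 * coeff q n
coeff-*-constant []      q _   n = sym (*-zeroˡ (coeff q n))
coeff-*-constant (a ∷ p) q p≤0 n = begin
    coeff ((a ∷ p) *ₚ q) n                   ≡⟨ coeff-cons-* a p q n ⟩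
    a * coeff q n + coeff (0ℚ ∷ (p *ₚ q)) n  ≡⟨ cong (a * coeff q n +_) (shifted-vanishes n) ⟩
    a * coeff q n + 0ℚ                       ≡⟨ +-identityʳ _ ⟩
    a * coeff q n                            ∎
  where
    shifted-vanishes : ∀ n → coeff (0ℚ ∷ (p *ₚ q)) n ≡ 0ℚ
    shifted-vanishes zero    = refl
    shifted-vanishes (suc n) = begin
      coeff (p *ₚ q) n      ≡⟨ coeff-*-constant p q (λ k _ → p≤0 (suc k) z<s) n ⟩
      coeff p 0 * coeff q n ≡⟨ cong (_* coeff q n) (p≤0 1 z<s) ⟩
      0ℚ * coeff q n        ≡⟨ *-zeroˡ (coeff q n) ⟩
      0ℚ                    ∎

Leading-* : ∀ {p q a b x y} → Leading p a x → Leading q b y → Leading (p *ₚ q) (a ℕ.+ b) (x * y)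
Leading-* {p} {q} {zero} {b} {x} {y} lp lq = record
  { bound = λ n b<n → trans (coeff-*-constant p q (bound lp) n)
                            (trans (cong (coeff p 0 *_) (bound lq n b<n)) (*-zeroʳ (coeff p 0)))
  ; top   = trans (coeff-*-constant p q (bound lp) b) (cong₂ _*_ (top lp) (top lq))
  }
Leading-* {[]} {q} {suc a} {b} {x} {y} lp lq = record
  { bound = λ _ _ → refl
  ; top   = sym (trans (cong (_* y) (sym (top lp))) (*-zeroˡ y))
  }
Leading-* {c ∷ p} {q} {suc a} {b} {x} {y} lp lq = record
  { bound = λ { (suc n) (s≤s a+b<n) →
      trans (drop-head n (bound lq (suc n) (ℕ.m<n⇒m<1+n (ℕ.≤-<-trans (ℕ.m≤n+m b a) a+b<n))))
            (bound rest n a+b<n) }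
  ; top   = trans (drop-head (a ℕ.+ b) (bound lq (suc (a ℕ.+ b)) (s≤s (ℕ.m≤n+m b a)))) (top rest)
  }
  where
    rest : Leading (p *ₚ q) (a ℕ.+ b) (x * y)
    rest = Leading-* {p} {q} {a} {b} {x} {y} (record { bound = λ n a<n → bound lp (suc n) (s≤s a<n) ; top = top lp }) lq
    drop-head : ∀ n → coeff q (suc n) ≡ 0ℚ → coeff ((c ∷ p) *ₚ q) (suc n) ≡ coeff (p *ₚ q) n
    drop-head n q₀ = trans (coeff-cons-* c p q (suc n))
                           (trans (cong (λ z → c * z + coeff (p *ₚ q) n) q₀) (simplify c _))
      where
        simplify : ∀ u v → u * 0ℚ + v ≡ v
        simplify = solve-∀ ℚ-ring

Leading-scale : ∀ {p d c} a → Leading p d c → Leading (scaleₚ a p) d (a * c)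
Leading-scale {p} a lp = record
  { bound = λ n d<n → trans (coeff-scale a p n) (trans (cong (a *_) (bound lp n d<n)) (*-zeroʳ a))
  ; top   = trans (coeff-scale a p _) (cong (a *_) (top lp))
  }

Leading-neg : ∀ {p d c} → Leading p d c → Leading (-_ₚ p) d (- c)
Leading-neg {p} lp = record
  { bound = λ n d<n → trans (coeff-neg p n) (cong -_ (bound lp n d<n))
  ; top   = trans (coeff-neg p _) (cong -_ (top lp))
  }

coeff-t*-deriv : ∀ p n → coeff (tₚ *ₚ deriv p) n ≡ ℕtoℚ n * coeff p n
coeff-t*-deriv p zero = begin
    coeff (tₚ *ₚ deriv p) 0              ≡⟨ coeff-cons-* 0ℚ (1ℚ ∷ []) (deriv p) 0 ⟩
    0ℚ * coeff (deriv p) 0 + 0ℚ          ≡⟨ trans (+-identityʳ (0ℚ * coeff (deriv p) 0)) (*-zeroˡ (coeff (deriv p) 0)) ⟩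
    0ℚ                                   ≡⟨ sym (*-zeroˡ (coeff p 0)) ⟩
    ℕtoℚ 0 * coeff p 0                   ∎
coeff-t*-deriv p (suc n) = begin
    coeff (tₚ *ₚ deriv p) (suc n)                       ≡⟨ coeff-cons-* 0ℚ (1ℚ ∷ []) (deriv p) (suc n) ⟩
    0ℚ * coeff (deriv p) (suc n) + coeff ((1ℚ ∷ []) *ₚ deriv p) n
      ≡⟨ cong₂ _+_ (*-zeroˡ (coeff (deriv p) (suc n))) (coeff-*-constant (1ℚ ∷ []) (deriv p) (λ { (suc _) _ → refl }) n) ⟩
    0ℚ + 1ℚ * coeff (deriv p) n                         ≡⟨ trans (+-identityˡ _) (*-identityˡ _) ⟩
    coeff (deriv p) n                                   ≡⟨ coeff-deriv p n ⟩
    ℕtoℚ (suc n) * coeff p (suc n)                      ∎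
  where
    coeff-derivAux : ∀ k p n → coeff (derivAux k p) n ≡ ℕtoℚ (k ℕ.+ n) * coeff p n
    coeff-derivAux k []      n       = sym (*-zeroʳ (ℕtoℚ (k ℕ.+ n)))
    coeff-derivAux k (a ∷ p) zero    = cong (λ i → ℕtoℚ i * a) (sym (ℕ.+-identityʳ k))
    coeff-derivAux k (a ∷ p) (suc n) =
      trans (coeff-derivAux (suc k) p n) (cong (λ i → ℕtoℚ i * coeff p n) (sym (ℕ.+-suc k n)))
    coeff-deriv : ∀ p n → coeff (deriv p) n ≡ ℕtoℚ (suc n) * coeff p (suc n)
    coeff-deriv []      n = sym (*-zeroʳ (ℕtoℚ (suc n)))
    coeff-deriv (a ∷ p) n = coeff-derivAux 1 p n

coeff-[1-t]* : ∀ p n → coeff ((1ₚ +ₚ (-_ₚ tₚ)) *ₚ p) (suc n) ≡ coeff p (suc n) - coeff p n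
coeff-[1-t]* p n = begin
    coeff ((1ₚ +ₚ (-_ₚ tₚ)) *ₚ p) (suc n)               ≡⟨ coeff-cons-* 1ℚ ((- 1ℚ) ∷ []) p (suc n) ⟩
    1ℚ * coeff p (suc n) + coeff (((- 1ℚ) ∷ []) *ₚ p) n
      ≡⟨ cong (1ℚ * coeff p (suc n) +_) (coeff-*-constant ((- 1ℚ) ∷ []) p (λ { (suc _) _ → refl }) n) ⟩
    1ℚ * coeff p (suc n) + (- 1ℚ) * coeff p n           ≡⟨ simplify (coeff p (suc n)) (coeff p n) ⟩
    coeff p (suc n) - coeff p n                         ∎
  where
    simplify : ∀ u v → 1ℚ * u + (- 1ℚ) * v ≡ u - v
    simplify = solve-∀ ℚ-ring

Σ : ℕ → (ℕ → ℚ) → ℚ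
Σ zero    φ = 0ℚ
Σ (suc n) φ = φ 0 + Σ n (λ i → φ (suc i))

Σ-snoc : ∀ n φ → Σ (suc n) φ ≡ Σ n φ + φ n
Σ-snoc zero    φ = trans (+-identityʳ (φ 0)) (sym (+-identityˡ (φ 0)))
Σ-snoc (suc n) φ = begin
    φ 0 + Σ (suc n) (λ i → φ (suc i))       ≡⟨ cong (φ 0 +_) (Σ-snoc n (λ i → φ (suc i))) ⟩
    φ 0 + (Σ n (λ i → φ (suc i)) + φ (suc n)) ≡⟨ sym (+-assoc (φ 0) _ _) ⟩
    Σ (suc n) φ + φ (suc n)                 ∎

Σ-zero : ∀ n → Σ n (λ _ → 0ℚ) ≡ 0ℚ
Σ-zero zero    = refl
Σ-zero (suc n) = trans (+-identityˡ _) (Σ-zero n)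

Σ-cong : ∀ n {φ ψ} → (∀ i → i < n → φ i ≡ ψ i) → Σ n φ ≡ Σ n ψ
Σ-cong zero    eq = refl
Σ-cong (suc n) eq = cong₂ _+_ (eq 0 z<s) (Σ-cong n (λ i i<n → eq (suc i) (s≤s i<n)))

Σ-telescope : ∀ n u → Σ n (λ j → u j - u (suc j)) ≡ u 0 - u n
Σ-telescope zero    u = sym (+-inverseʳ (u 0))
Σ-telescope (suc n) u = trans (cong ((u 0 - u 1) +_) (Σ-telescope n (λ j → u (suc j))))
                              (collapse (u 0) (u 1) (u (suc n)))
  where
    collapse : ∀ a b c → (a - b) + (b - c) ≡ a - c
    collapse = solve-∀ ℚ-ring

coeff-sumₚ-vanishing : ∀ n (P : Fin n → Poly) c → (∀ k → coeff (P k) c ≡ 0ℚ) → coeff (sumₚ n P) c ≡ 0ℚ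
coeff-sumₚ-vanishing zero    P c _  = refl
coeff-sumₚ-vanishing (suc n) P c P₀ =
  trans (coeff-+ (P Fin.zero) _ c)
        (trans (cong₂ _+_ (P₀ Fin.zero) (coeff-sumₚ-vanishing n (λ k → P (Fin.suc k)) c (λ k → P₀ (Fin.suc k))))
               (+-identityˡ 0ℚ))

coeff-sumₚ-triangular : ∀ n (P : Fin n → Poly) c R (φ : ℕ → ℚ) b → R < n →
  (∀ k → toℕ k < R → coeff (P k) c ≡ φ (toℕ k)) →
  (∀ k → toℕ k ≡ R → coeff (P k) c ≡ b) →
  (∀ k → R < toℕ k → coeff (P k) c ≡ 0ℚ) →
  coeff (sumₚ n P) c ≡ Σ R φ + b
coeff-sumₚ-triangular (suc n) P c zero φ b _ below diag above = begin
    coeff (P Fin.zero +ₚ sumₚ n (λ k → P (Fin.suc k))) c            ≡⟨ coeff-+ (P Fin.zero) _ c ⟩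
    coeff (P Fin.zero) c + coeff (sumₚ n (λ k → P (Fin.suc k))) c
      ≡⟨ cong₂ _+_ (diag Fin.zero refl)
                   (coeff-sumₚ-vanishing n _ c (λ k → above (Fin.suc k) z<s)) ⟩
    b + 0ℚ                                                           ≡⟨ trans (+-identityʳ b) (sym (+-identityˡ b)) ⟩
    0ℚ + b                                                           ∎
coeff-sumₚ-triangular (suc n) P c (suc R) φ b (s≤s R<n) below diag above = begin
    coeff (P Fin.zero +ₚ sumₚ n (λ k → P (Fin.suc k))) c            ≡⟨ coeff-+ (P Fin.zero) _ c ⟩
    coeff (P Fin.zero) c + coeff (sumₚ n (λ k → P (Fin.suc k))) c
      ≡⟨ cong₂ _+_ (below Fin.zero z<s)
           (coeff-sumₚ-triangular n (λ k → P (Fin.suc k)) c R (λ i → φ (suc i)) b R<n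
              (λ k k<R → below (Fin.suc k) (s≤s k<R))
              (λ k k≡R → diag (Fin.suc k) (cong suc k≡R))
              (λ k R<k → above (Fin.suc k) (s≤s R<k))) ⟩
    φ 0 + (Σ R (λ i → φ (suc i)) + b)                                ≡⟨ sym (+-assoc (φ 0) _ b) ⟩
    Σ (suc R) φ + b                                                  ∎

-- The leading-coefficient table L

previous : (ℕ → ℚ) → ℕ → ℚ
previous φ zero    = 0ℚ
previous φ (suc j) = φ j

-- L r j will be the coefficient of t^(r-j) in f_{r,j+1}.
L : ℕ → ℕ → ℚ
L zero    zero    = 1ℚ
L zero    (suc j) = 0ℚ
L (suc r) j       = - (ℕtoℚ (suc j) * L r j) - ℕtoℚ j * previous (L r) j

L-above-diagonal : ∀ r j → r < j → L r j ≡ 0ℚ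
L-above-diagonal zero    (suc j) _         = refl
L-above-diagonal (suc r) (suc j) (s≤s r<j) =
  trans (cong₂ (λ x y → - (ℕtoℚ (suc (suc j)) * x) - ℕtoℚ (suc j) * y)
               (L-above-diagonal r (suc j) (ℕ.m<n⇒m<1+n r<j)) (L-above-diagonal r j r<j))
        (vanish (ℕtoℚ (suc (suc j))) (ℕtoℚ (suc j)))
  where
    vanish : ∀ a b → - (a * 0ℚ) - b * 0ℚ ≡ 0ℚ
    vanish = solve-∀ ℚ-ring

L-diagonal-step : ∀ r → L (suc r) (suc r) ≡ - (ℕtoℚ (suc r) * L r r)
L-diagonal-step r =
  trans (cong (λ x → - (ℕtoℚ (suc (suc r)) * x) - ℕtoℚ (suc r) * L r r)
              (L-above-diagonal r (suc r) ℕ.≤-refl))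
        (simplify (ℕtoℚ (suc (suc r))) (ℕtoℚ (suc r)) (L r r))
  where
    simplify : ∀ a b l → - (a * 0ℚ) - b * l ≡ - (b * l)
    simplify = solve-∀ ℚ-ring

-- The diagonal entries are (-1)^r r!, in particular nonzero.
L-diagonal-nonzero : ∀ r → L r r ≢ 0ℚ
L-diagonal-nonzero zero    = 1≢0
L-diagonal-nonzero (suc r) eq =
  *-nonzero (ℕtoℚ (suc r)) (L r r) (ℕtoℚ-suc-nonzero r) (L-diagonal-nonzero r)
            (negation-vanishes (trans (sym (L-diagonal-step r)) eq))
  where
    negation-vanishes : ∀ {x} → - x ≡ 0ℚ → x ≡ 0ℚ
    negation-vanishes {x} -x≡0 = trans (sym (double-negation x)) (cong -_ -x≡0)
      where
        double-negation : ∀ x → - (- x) ≡ x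
        double-negation = solve-∀ ℚ-ring

[_≡0] : ℕ → ℚ
[ zero  ≡0] = 1ℚ
[ suc _ ≡0] = 0ℚ

L-alternating-sum : ∀ r → Σ (suc r) (λ i → L r i * signℚ i) ≡ [ r ≡0]
L-alternating-sum zero    = refl
L-alternating-sum (suc r) = begin
    Σ (suc (suc r)) (λ i → L (suc r) i * signℚ i)   ≡⟨ Σ-cong (suc (suc r)) (λ j _ → as-difference j) ⟩
    Σ (suc (suc r)) (λ j → u j - u (suc j))         ≡⟨ Σ-telescope (suc (suc r)) u ⟩
    u 0 - u (suc (suc r))                           ≡⟨ cong (λ x → u 0 - ℕtoℚ (suc (suc r)) * x * signℚ (suc r))
                                                            (L-above-diagonal r (suc r) ℕ.≤-refl) ⟩
    ℕtoℚ 0 * 0ℚ * 0ℚ - ℕtoℚ (suc (suc r)) * 0ℚ * signℚ (suc r)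
                                                    ≡⟨ vanish (ℕtoℚ 0) (ℕtoℚ (suc (suc r))) (signℚ (suc r)) ⟩
    0ℚ                                              ∎
  where
    -- u j = j L_{r,j-1} (-1)^(j-1); the summands are its successive differences
    u : ℕ → ℚ
    u j = ℕtoℚ j * previous (L r) j * previous signℚ j
    as-difference : ∀ j → L (suc r) j * signℚ j ≡ u j - u (suc j)
    as-difference zero    = first (ℕtoℚ 1) (ℕtoℚ 0) (L r 0)
      where
        first : ∀ a b l → (- (a * l) - b * 0ℚ) * 1ℚ ≡ b * 0ℚ * 0ℚ - a * l * 1ℚ
        first = solve-∀ ℚ-ring
    as-difference (suc j) = later (ℕtoℚ (suc (suc j))) (ℕtoℚ (suc j)) (L r (suc j)) (L r j) (signℚ j)
      where
        later : ∀ a b l₁ l₀ s → (- (a * l₁) - b * l₀) * (- s) ≡ b * l₀ * s - a * l₁ * (- s)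
        later = solve-∀ ℚ-ring
    vanish : ∀ a b s → a * 0ℚ * 0ℚ - b * 0ℚ * s ≡ 0ℚ
    vanish = solve-∀ ℚ-ring

-- Degrees and leading coefficients of the polynomials f

coeff-f-interior : ∀ r j n → j ≤ r →
  coeff (f (suc r) (suc j)) (suc n) ≡
    ℕtoℚ (suc n) * coeff (f r (suc j)) (suc n)
      + (ℕtoℚ (suc j) * (coeff (f r (suc j)) (suc n) - coeff (f r (suc j)) n)
      + - coeff (scaleₚ (ℕtoℚ j) (f r j)) (suc n))
coeff-f-interior r j n j≤r rewrite <ᵇ-true (s≤s j≤r) = begin
    coeff ((tₚ *ₚ deriv P) +ₚ (scaleₚ (ℕtoℚ (suc j)) ((1ₚ +ₚ (-_ₚ tₚ)) *ₚ P) +ₚ (-_ₚ Q))) (suc n)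
      ≡⟨ coeff-+ (tₚ *ₚ deriv P) _ (suc n) ⟩
    coeff (tₚ *ₚ deriv P) (suc n) + coeff (scaleₚ (ℕtoℚ (suc j)) ((1ₚ +ₚ (-_ₚ tₚ)) *ₚ P) +ₚ (-_ₚ Q)) (suc n)
      ≡⟨ cong₂ _+_ (coeff-t*-deriv P (suc n)) (coeff-+ (scaleₚ (ℕtoℚ (suc j)) ((1ₚ +ₚ (-_ₚ tₚ)) *ₚ P)) _ (suc n)) ⟩
    ℕtoℚ (suc n) * coeff P (suc n)
      + (coeff (scaleₚ (ℕtoℚ (suc j)) ((1ₚ +ₚ (-_ₚ tₚ)) *ₚ P)) (suc n) + coeff (-_ₚ Q) (suc n))
      ≡⟨ cong (ℕtoℚ (suc n) * coeff P (suc n) +_)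
              (cong₂ _+_ (trans (coeff-scale (ℕtoℚ (suc j)) ((1ₚ +ₚ (-_ₚ tₚ)) *ₚ P) (suc n)) (cong (ℕtoℚ (suc j) *_) (coeff-[1-t]* P n)))
                         (coeff-neg Q (suc n))) ⟩
    ℕtoℚ (suc n) * coeff P (suc n) + (ℕtoℚ (suc j) * (coeff P (suc n) - coeff P n) + - coeff Q (suc n)) ∎
  where
    P = f r (suc j)
    Q = scaleₚ (ℕtoℚ j) (f r j)

f-boundary : ∀ r → f (suc r) (suc (suc r)) ≡ -_ₚ (scaleₚ (ℕtoℚ (suc r)) (f r (suc r)))
f-boundary r rewrite <ᵇ-false (ℕ.≤-refl {suc r}) | ≡ᵇ-refl r = refl

Leading-interior-step : ∀ r j {D ℓ κ} → j ≤ r →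
  Leading (f r (suc j)) D ℓ → Leading (scaleₚ (ℕtoℚ j) (f r j)) (suc D) κ →
  Leading (f (suc r) (suc j)) (suc D) (- (ℕtoℚ (suc j) * ℓ) - κ)
Leading-interior-step r j {D} {ℓ} {κ} j≤r lp lq = record
  { bound = λ { (suc n) (s≤s D<n) → trans (coeff-f-interior r j n j≤r)
      (trans (cong₂ (λ x z → ℕtoℚ (suc n) * x + (ℕtoℚ (suc j) * (x - coeff P n) + - z))
                    (bound lp (suc n) (ℕ.m<n⇒m<1+n D<n)) (bound lq (suc n) (s≤s D<n)))
      (trans (cong (λ y → ℕtoℚ (suc n) * 0ℚ + (ℕtoℚ (suc j) * (0ℚ - y) + - 0ℚ)) (bound lp n D<n))
             (vanish (ℕtoℚ (suc n)) (ℕtoℚ (suc j))))) }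
  ; top   = trans (coeff-f-interior r j D j≤r)
      (trans (cong₂ (λ x z → ℕtoℚ (suc D) * x + (ℕtoℚ (suc j) * (x - coeff P D) + - z))
                    (bound lp (suc D) ℕ.≤-refl) (top lq))
      (trans (cong (λ y → ℕtoℚ (suc D) * 0ℚ + (ℕtoℚ (suc j) * (0ℚ - y) + - κ)) (top lp))
             (leading (ℕtoℚ (suc D)) (ℕtoℚ (suc j)) ℓ κ)))
  }
  where
    P = f r (suc j)
    vanish : ∀ a b → a * 0ℚ + (b * (0ℚ - 0ℚ) + - 0ℚ) ≡ 0ℚ
    vanish = solve-∀ ℚ-ring
    leading : ∀ a b l w → a * 0ℚ + (b * (0ℚ - l) + - w) ≡ - (b * l) - w
    leading = solve-∀ ℚ-ring

f-leading : ∀ r j → j ≤ r → Leading (f r (suc j)) (r ∸ j) (L r j)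
f-leading zero    zero    z≤n   = record { bound = λ { (suc n) _ → refl } ; top = refl }
f-leading (suc r) j       j≤1+r with ℕ.m≤n⇒m<n∨m≡n j≤1+r
... | inj₁ (s≤s j≤r) = subst (λ d → Leading (f (suc r) (suc j)) d (L (suc r) j)) (sym (ℕ.+-∸-assoc 1 j≤r))
                             (Leading-interior-step r j j≤r (f-leading r j j≤r) (lower-term j j≤r))
  where
    lower-term : ∀ j → j ≤ r → Leading (scaleₚ (ℕtoℚ j) (f r j)) (suc (r ∸ j)) (ℕtoℚ j * previous (L r) j)
    lower-term zero    _     = record
      { bound = λ n _ → trans (coeff-scale (ℕtoℚ 0) (f r 0) n) (*-zeroˡ (coeff (f r 0) n))
      ; top   = trans (coeff-scale (ℕtoℚ 0) (f r 0) (suc r)) (trans (*-zeroˡ (coeff (f r 0) (suc r))) (sym (*-zeroˡ 0ℚ)))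
      }
    lower-term (suc j) 1+j≤r = subst (λ d → Leading (scaleₚ (ℕtoℚ (suc j)) (f r (suc j))) d (ℕtoℚ (suc j) * L r j))
                                     (ℕ.+-∸-assoc 1 1+j≤r)
                                     (Leading-scale (ℕtoℚ (suc j)) (f-leading r j (ℕ.<⇒≤ 1+j≤r)))
... | inj₂ refl = subst₂ (λ p d → Leading p d (L (suc r) (suc r))) (sym (f-boundary r)) refl
                         (subst (Leading _ (r ∸ r)) (sym (L-diagonal-step r))
                                (Leading-neg (Leading-scale (ℕtoℚ (suc r)) (f-leading r r ℕ.≤-refl))))

-- Column 0 of an inverse of A_m

-- column 0 of the identity matrix, row R: the constant [R = 0]
unit-above : ∀ R c → R < c → coeff (if R ≡ᵇ 0 then 1ₚ else 0ₚ) c ≡ 0ℚ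
unit-above zero    (suc c) _ = refl
unit-above (suc R) c       _ = refl

unit-top : ∀ R → coeff (if R ≡ᵇ 0 then 1ₚ else 0ₚ) R ≡ [ R ≡0]
unit-top zero    = refl
unit-top (suc R) = refl

module InverseColumn (m : ℕ) (G : Matrix (suc m)) (inverse : IsInverse (A m) G) where

  g : Fin (suc m) → Poly
  g k = G k zero

  Claim : Fin (suc m) → Set
  Claim k = Leading (g k) (toℕ k) (signℚ (toℕ k))

  A-below : ∀ r k → toℕ k ≤ toℕ r → A m r k ≡ f (toℕ r) (suc (toℕ k))
  A-below r k k≤r rewrite <ᵇ-true (s≤s k≤r) = refl

  A-above : ∀ r k → toℕ r < toℕ k → A m r k ≡ 0ₚ
  A-above r k r<k rewrite <ᵇ-false r<k = refl

  row-equation : ∀ r c → coeff (sumₚ (suc m) (λ k → A m r k *ₚ g k)) c ≡ coeff (if toℕ r ≡ᵇ 0 then 1ₚ else 0ₚ) c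
  row-equation r c = proj₁ inverse r zero c

  coeff-diagonal-term : ∀ r c → coeff (A m r r *ₚ g r) c ≡ L (toℕ r) (toℕ r) * coeff (g r) c
  coeff-diagonal-term r c = begin
      coeff (A m r r *ₚ g r) c                 ≡⟨ cong (λ p → coeff (p *ₚ g r) c) (A-below r r ℕ.≤-refl) ⟩
      coeff (f R (suc R) *ₚ g r) c             ≡⟨ coeff-*-constant (f R (suc R)) (g r) (bound constant) c ⟩
      coeff (f R (suc R)) 0 * coeff (g r) c    ≡⟨ cong (_* coeff (g r) c) (top constant) ⟩
      L R R * coeff (g r) c                    ∎
    where
      R = toℕ r
      constant : Leading (f R (suc R)) 0 (L R R)
      constant = subst (λ d → Leading (f R (suc R)) d (L R R)) (ℕ.n∸n≡0 R) (f-leading R R ℕ.≤-refl)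

  row-expansion : ∀ r c (φ : ℕ → ℚ) → (∀ k → toℕ k < toℕ r → coeff (A m r k *ₚ g k) c ≡ φ (toℕ k)) →
    Σ (toℕ r) φ + L (toℕ r) (toℕ r) * coeff (g r) c ≡ coeff (if toℕ r ≡ᵇ 0 then 1ₚ else 0ₚ) c
  row-expansion r c φ below =
    trans (sym (coeff-sumₚ-triangular (suc m) (λ k → A m r k *ₚ g k) c (toℕ r) φ
                                      (L (toℕ r) (toℕ r) * coeff (g r) c) (Fin.toℕ<n r) below diagonal above))
          (row-equation r c)
    where
      diagonal : ∀ k → toℕ k ≡ toℕ r → coeff (A m r k *ₚ g k) c ≡ L (toℕ r) (toℕ r) * coeff (g r) c
      diagonal k k≡r rewrite Fin.toℕ-injective k≡r = coeff-diagonal-term r c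
      above : ∀ k → toℕ r < toℕ k → coeff (A m r k *ₚ g k) c ≡ 0ℚ
      above k r<k rewrite A-above r k r<k = refl

  solve-row : ∀ r → (∀ k → toℕ k < toℕ r → Claim k) → Claim r
  solve-row r earlier = record
    { bound = λ c R<c → *-cancelˡ (L R R) (coeff (g r) c) 0ℚ (L-diagonal-nonzero R)
                          (trans (diagonal-vanishes c R<c) (sym (*-zeroʳ (L R R))))
    ; top   = *-cancelˡ (L R R) (coeff (g r) R) (signℚ R) (L-diagonal-nonzero R)
                (∙-cancelˡ (Σ R ζ) _ _ top-row)
    }
    where
      R = toℕ r
      ζ : ℕ → ℚ
      ζ i = L R i * signℚ i
      term : ∀ k → toℕ k < R → Leading (A m r k *ₚ g k) R (ζ (toℕ k))
      term k k<R = subst₂ (λ p d → Leading (p *ₚ g k) d (ζ (toℕ k)))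
                          (sym (A-below r k (ℕ.<⇒≤ k<R))) (ℕ.m∸n+n≡m (ℕ.<⇒≤ k<R))
                          (Leading-* (f-leading R (toℕ k) (ℕ.<⇒≤ k<R)) (earlier k k<R))
      -- beyond t^R only the diagonal term survives, so it must vanish
      diagonal-vanishes : ∀ c → R < c → L R R * coeff (g r) c ≡ 0ℚ
      diagonal-vanishes c R<c = begin
        L R R * coeff (g r) c                     ≡⟨ sym (+-identityˡ _) ⟩
        0ℚ + L R R * coeff (g r) c                ≡⟨ cong (_+ L R R * coeff (g r) c) (sym (Σ-zero R)) ⟩
        Σ R (λ _ → 0ℚ) + L R R * coeff (g r) c    ≡⟨ row-expansion r c (λ _ → 0ℚ) (λ k k<R → bound (term k k<R) c R<c) ⟩
        coeff (if R ≡ᵇ 0 then 1ₚ else 0ₚ) c       ≡⟨ unit-above R c R<c ⟩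
        0ℚ                                        ∎
      -- at t^R the row reads like the alternating sum of row R of L
      top-row : Σ R ζ + L R R * coeff (g r) R ≡ Σ R ζ + L R R * signℚ R
      top-row = begin
        Σ R ζ + L R R * coeff (g r) R             ≡⟨ row-expansion r R ζ (λ k k<R → top (term k k<R)) ⟩
        coeff (if R ≡ᵇ 0 then 1ₚ else 0ₚ) R       ≡⟨ unit-top R ⟩
        [ R ≡0]                                   ≡⟨ sym (L-alternating-sum R) ⟩
        Σ (suc R) ζ                               ≡⟨ Σ-snoc R ζ ⟩
        Σ R ζ + L R R * signℚ R                   ∎

  all-rows : ∀ R k → toℕ k < R → Claim k
  all-rows (suc R) k k<1+R with ℕ.m≤n⇒m<n∨m≡n (ℕ.≤-pred k<1+R)
  ... | inj₁ k<R  = all-rows R k k<R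
  ... | inj₂ refl = solve-row k (all-rows R)

  last-row : Claim (fromℕ m)
  last-row = all-rows (suc m) (fromℕ m) (Fin.toℕ<n (fromℕ m))

corollary2p5 : (m : ℕ) (G : Matrix (suc m)) → IsInverse (A m) G →
    coeff (G (fromℕ m) zero) m ≡ signℚ m
corollary2p5 m G inv = subst (λ d → coeff (G (fromℕ m) zero) d ≡ signℚ d) (Fin.toℕ-fromℕ m) (top last-row)
  where open InverseColumn m G inv
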